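{- Let $\Gamma$ be a finite connected $G$-arc-transitive digraph of valency $k\geq 2$, where $G\leq\mathrm{Aut}(\Gamma)$, and let $(u,v)$ be an arc of $\Gamma$. Then (1) $\Gamma^+(u)\neq\{v\}\cup(\Gamma^+(u)\cap\Gamma^+(v))$; and (2) $\Gamma^+(u)\cap\Gamma^+(v)=\emptyset$ if and only if every $2$-arc of $\Gamma$ is a $2$-geodesic.
   Context: A digraph $\Gamma$ consists of a finite vertex set $V(\Gamma)$ with an antisymmetric irreflexive relation $\rightarrow$; an arc is an ordered pair $(u,v)$ with $u\rightarrow v$; $\Gamma^+(v)=\{w: v\rightarrow w\}$ and the valency is $|\Gamma^+(v)|$. Connected means the underlying undirected graph is connected. $G$-arc-transitive means $G$ is transitive on the set of arcs. A $2$-arc is a sequence $(v_0,v_1,v_2)$ with $v_0\rightarrow v_1\rightarrow v_2$; it is a $2$-geodesic if the length of a shortest directed path from $v_0$ to $v_2$ is $2$. -}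

module Defs where

open import Data.Nat using (ℕ; zero; suc; _<_)
open import Data.Fin using (Fin)
open import Data.Bool using (Bool; true; false)
open import Data.Vec using (tabulate)
open import Data.Product using (Σ; _×_; _,_; ∃)
open import Data.Sum using (_⊎_)
open import Relation.Nullary using (¬_)
open import Relation.Binary.PropositionalEquality using (_≡_)
open import Data.Fin.Subset using (Subset; ∣_∣)
open import Data.Fin.Permutation using (Permutation′; _⟨$⟩ʳ_; id; flip; _∘ₚ_)
open import Function.Bundles using (_⇔_)

record Digraph : Set where
  field
    n   : ℕ
    adj : Fin n → Fin n → Bool
    irrefl  : ∀ v → adj v v ≡ false
    antisym : ∀ u v → adj u v ≡ true → adj v u ≡ false

module _ (Γ : Digraph) where
  open Digraph Γ

  V : Set
  V = Fin n

  Arc : V → V → Set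
  Arc u v = adj u v ≡ true

  out : V → Subset n
  out v = tabulate (adj v)

  HasValency : ℕ → Set
  HasValency k = ∀ v → ∣ out v ∣ ≡ k

  data UWalk : V → V → Set where
    here : ∀ {v} → UWalk v v
    fwd  : ∀ {u w v} → Arc u w → UWalk w v → UWalk u v
    bwd  : ∀ {u w v} → Arc w u → UWalk w v → UWalk u v

  Connected : Set
  Connected = ∀ u v → UWalk u v

  data DWalk : V → V → ℕ → Set where
    here : ∀ {v} → DWalk v v zero
    step : ∀ {u w v m} → Arc u w → DWalk w v m → DWalk u v (suc m)

  IsAut : Permutation′ n → Set
  IsAut σ = ∀ u v → adj u v ≡ adj (σ ⟨$⟩ʳ u) (σ ⟨$⟩ʳ v)

  record IsAutSubgroup (G : Permutation′ n → Set) : Set where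
    field
      aut   : ∀ σ → G σ → IsAut σ
      hasId : G id
      comp  : ∀ σ τ → G σ → G τ → G (σ ∘ₚ τ)
      inv   : ∀ σ → G σ → G (flip σ)

  ArcTransitive : (Permutation′ n → Set) → Set
  ArcTransitive G = ∀ u v u′ v′ → Arc u v → Arc u′ v′ →
    Σ (Permutation′ n) λ g → G g × (g ⟨$⟩ʳ u ≡ u′) × (g ⟨$⟩ʳ v ≡ v′)

  TwoArc : V → V → V → Set
  TwoArc v₀ v₁ v₂ = Arc v₀ v₁ × Arc v₁ v₂

  TwoGeodesic : V → V → V → Set
  TwoGeodesic v₀ v₁ v₂ = TwoArc v₀ v₁ v₂ × (∀ m → m < 2 → ¬ DWalk v₀ v₂ m)

-- Arc-transitivity lets any automorphism mapping an arc (u,w) onto (u,v)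
-- transport local configurations. For (1): if every out-neighbour t ≠ v of u
-- were an out-neighbour of v, pick a second out-neighbour w of u and g ∈ G
-- with (u,w) ↦ (u,v); then v → w, and v → g v forces w → v, contradicting
-- antisymmetry. For (2): a 2-arc (x,y,z) fails to be a 2-geodesic exactly when
-- x → z, i.e. z is a common out-neighbour of the arc (x,y); moving (x,y) onto
-- (u,v) shows this happens for some arc iff Γ⁺(u) ∩ Γ⁺(v) ≠ ∅.
module Submission where

open import Defs
open import Data.Nat using (ℕ; _≤_; _<_; zero; suc; s≤s; z≤n)
open import Data.Nat.Properties using (module ≤-Reasoning)
open import Data.Product using (_×_; _,_; proj₁; proj₂)
open import Data.Sum using (inj₁; inj₂)
open import Data.Fin using (_≟_)
open import Data.Vec using (tabulate)
open import Data.Vec.Properties using (lookup∘tabulate; []=⇒lookup; lookup⇒[]=)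
open import Data.Empty using (⊥-elim)
open import Relation.Nullary using (¬_; yes; no)
open import Relation.Binary.PropositionalEquality using (_≡_; _≢_; refl; sym; trans; subst)
open import Data.Fin.Subset using (Subset; ⁅_⁆; _∪_; _∩_; ⊥; _∈_; _⊆_; ∣_∣; Nonempty)
open import Data.Fin.Subset.Properties
  using (x∈⁅x⁆; x∈⁅y⁆⇒x≡y; x∈p∪q⁻; x∈p∪q⁺; x∈p∩q⁻; x∈p∩q⁺; ∉⊥; p⊆q⇒∣p∣≤∣q∣; ∣⁅x⁆∣≡1; Empty-unique)
open import Data.Fin.Permutation using (Permutation′; _⟨$⟩ʳ_)
open import Function.Bundles using (_⇔_; mk⇔; Injection)
open import Function.Properties.Inverse using (↔⇒↣)

p≡r∪[p∩q]⇒p⊆r∪q : ∀ {n} {p q r : Subset n} → p ≡ r ∪ (p ∩ q) → p ⊆ r ∪ q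
p≡r∪[p∩q]⇒p⊆r∪q {p = p} {q} {r} p≡ x∈p with x∈p∪q⁻ r (p ∩ q) (subst (_ ∈_) p≡ x∈p)
... | inj₁ x∈r   = x∈p∪q⁺ (inj₁ x∈r)
... | inj₂ x∈p∩q = x∈p∪q⁺ (inj₂ (proj₂ (x∈p∩q⁻ p q x∈p∩q)))

module _ (Γ : Digraph) where
  open Digraph Γ

  ∈-out⁺ : ∀ {u x} → Arc Γ u x → x ∈ out Γ u
  ∈-out⁺ {u} {x} ux = lookup⇒[]= x (tabulate (adj u)) (trans (lookup∘tabulate (adj u) x) ux)

  ∈-out⁻ : ∀ {u x} → x ∈ out Γ u → Arc Γ u x
  ∈-out⁻ {u} {x} x∈out = trans (sym (lookup∘tabulate (adj u) x)) ([]=⇒lookup x∈out)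

  Arc-asym : ∀ {u v} → Arc Γ u v → ¬ Arc Γ v u
  Arc-asym {u} {v} uv vu with trans (sym vu) (antisym u v uv)
  ... | ()

  ∈-common-out : ∀ {u v x} → Arc Γ u x → Arc Γ v x → x ∈ out Γ u ∩ out Γ v
  ∈-common-out ux vx = x∈p∩q⁺ (∈-out⁺ ux , ∈-out⁺ vx)

  valency≥2⇒out⊈⁅⁆ : ∀ {k} → 2 ≤ k → HasValency Γ k → ∀ u v → ¬ (out Γ u ⊆ ⁅ v ⁆)
  valency≥2⇒out⊈⁅⁆ {k} 2≤k valency u v out⊆⁅v⁆ with (begin
    2            ≤⟨ 2≤k ⟩
    k            ≡⟨ valency u ⟨
    ∣ out Γ u ∣  ≤⟨ p⊆q⇒∣p∣≤∣q∣ out⊆⁅v⁆ ⟩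
    ∣ ⁅ v ⁆ ∣    ≡⟨ ∣⁅x⁆∣≡1 v ⟩
    1            ∎)
    where open ≤-Reasoning
  ... | s≤s ()

  Aut-preserves-Arc : ∀ σ → IsAut Γ σ → ∀ {u v} → Arc Γ u v → Arc Γ (σ ⟨$⟩ʳ u) (σ ⟨$⟩ʳ v)
  Aut-preserves-Arc _ isAut {u} {v} uv = trans (sym (isAut u v)) uv

  Aut-reflects-Arc : ∀ σ → IsAut Γ σ → ∀ {u v} → Arc Γ (σ ⟨$⟩ʳ u) (σ ⟨$⟩ʳ v) → Arc Γ u v
  Aut-reflects-Arc _ isAut {u} {v} σuσv = trans (isAut u v) σuσv

  TwoGeodesic⇒¬Arc : ∀ {x y z} → TwoGeodesic Γ x y z → ¬ Arc Γ x z
  TwoGeodesic⇒¬Arc (_ , noShortWalk) xz = noShortWalk 1 (s≤s (s≤s z≤n)) (step xz here)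

  TwoArc∧¬Arc⇒TwoGeodesic : ∀ {x y z} → TwoArc Γ x y z → ¬ Arc Γ x z → TwoGeodesic Γ x y z
  TwoArc∧¬Arc⇒TwoGeodesic {x} {y} {z} (xy , yz) ¬xz = (xy , yz) , noShortWalk
    where
    noShortWalk : ∀ m → m < 2 → ¬ DWalk Γ x z m
    noShortWalk zero          _              here           = Arc-asym xy yz
    noShortWalk (suc zero)    _              (step xz here) = ¬xz xz
    noShortWalk (suc (suc m)) (s≤s (s≤s ())) _

  module _ {G : Permutation′ n → Set} (G⊆Aut : ∀ σ → G σ → IsAut Γ σ)
           (arcTransitive : ArcTransitive Γ G) where

    common-out-transport : ∀ {x y u v} → Arc Γ x y → Arc Γ u v →
      Nonempty (out Γ x ∩ out Γ y) → Nonempty (out Γ u ∩ out Γ v)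
    common-out-transport {x} {y} {u} {v} xy uv (z , z∈common)
      with arcTransitive x y u v xy uv
    ... | g , g∈G , gx≡u , gy≡v = g ⟨$⟩ʳ z , ∈-common-out (image xz gx≡u) (image yz gy≡v)
      where
      xz = ∈-out⁻ (proj₁ (x∈p∩q⁻ (out Γ x) (out Γ y) z∈common))
      yz = ∈-out⁻ (proj₂ (x∈p∩q⁻ (out Γ x) (out Γ y) z∈common))
      image : ∀ {a b} → Arc Γ a z → g ⟨$⟩ʳ a ≡ b → Arc Γ b (g ⟨$⟩ʳ z)
      image az ga≡b = subst (λ b → Arc Γ b (g ⟨$⟩ʳ z)) ga≡b (Aut-preserves-Arc g (G⊆Aut g g∈G) az)

    out⊆⁅⁆∪out⇒out⊆⁅⁆ : ∀ {u v} → Arc Γ u v → out Γ u ⊆ ⁅ v ⁆ ∪ out Γ v → out Γ u ⊆ ⁅ v ⁆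
    out⊆⁅⁆∪out⇒out⊆⁅⁆ {u} {v} uv out⊆ {w} w∈out with w ≟ v
    ... | yes refl = x∈⁅x⁆ v
    ... | no w≢v with arcTransitive u w u v (∈-out⁻ w∈out) uv
    ... | g , g∈G , gu≡u , gw≡v = ⊥-elim (Arc-asym (vOut w∈out w≢v) wv)
      where
      isAut = G⊆Aut g g∈G
      vOut : ∀ {t} → t ∈ out Γ u → t ≢ v → Arc Γ v t
      vOut t∈out t≢v with x∈p∪q⁻ ⁅ v ⁆ (out Γ v) (out⊆ t∈out)
      ... | inj₁ t∈⁅v⁆ = ⊥-elim (t≢v (x∈⁅y⁆⇒x≡y v t∈⁅v⁆))
      ... | inj₂ t∈outv = ∈-out⁻ t∈outv
      ugv : Arc Γ u (g ⟨$⟩ʳ v)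
      ugv = subst (λ a → Arc Γ a (g ⟨$⟩ʳ v)) gu≡u (Aut-preserves-Arc g isAut uv)
      gv≢v : g ⟨$⟩ʳ v ≢ v
      gv≢v gv≡v = w≢v (Injection.injective (↔⇒↣ g) (trans gw≡v (sym gv≡v)))
      wv : Arc Γ w v
      wv = Aut-reflects-Arc g isAut (subst (λ a → Arc Γ a (g ⟨$⟩ʳ v)) (sym gw≡v)
             (vOut (∈-out⁺ ugv) gv≢v))

lemma2p1 : (Γ : Digraph) (G : Permutation′ (Digraph.n Γ) → Set) (k : ℕ) →
    2 ≤ k → HasValency Γ k → Connected Γ → IsAutSubgroup Γ G → ArcTransitive Γ G →
    ∀ u v → Arc Γ u v →
    (out Γ u ≢ ⁅ v ⁆ ∪ (out Γ u ∩ out Γ v))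
    × ((out Γ u ∩ out Γ v ≡ ⊥) ⇔ (∀ x y z → TwoArc Γ x y z → TwoGeodesic Γ x y z))
lemma2p1 Γ G k 2≤k valency _ subgroup arcTransitive u v uv =
  out≢⁅⁆∪common , mk⇔ noCommon⇒geodesic geodesic⇒noCommon
  where
  open IsAutSubgroup subgroup using (aut)

  out≢⁅⁆∪common : out Γ u ≢ ⁅ v ⁆ ∪ (out Γ u ∩ out Γ v)
  out≢⁅⁆∪common out≡ = valency≥2⇒out⊈⁅⁆ Γ 2≤k valency u v
    (out⊆⁅⁆∪out⇒out⊆⁅⁆ Γ aut arcTransitive uv (p≡r∪[p∩q]⇒p⊆r∪q out≡))

  noCommon⇒geodesic : out Γ u ∩ out Γ v ≡ ⊥ →
    ∀ x y z → TwoArc Γ x y z → TwoGeodesic Γ x y z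
  noCommon⇒geodesic noCommon x y z (xy , yz) = TwoArc∧¬Arc⇒TwoGeodesic Γ (xy , yz) λ xz →
    let w , w∈common = common-out-transport Γ aut arcTransitive xy uv (z , ∈-common-out Γ xz yz)
    in ∉⊥ (subst (w ∈_) noCommon w∈common)

  geodesic⇒noCommon : (∀ x y z → TwoArc Γ x y z → TwoGeodesic Γ x y z) →
    out Γ u ∩ out Γ v ≡ ⊥
  geodesic⇒noCommon geodesic = Empty-unique λ (w , w∈common) →
    let uw , vw = x∈p∩q⁻ (out Γ u) (out Γ v) w∈common
    in TwoGeodesic⇒¬Arc Γ (geodesic u v w (uv , ∈-out⁻ Γ vw)) (∈-out⁻ Γ uw)
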